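{- For every agent $a\in A$, all initial secret distributions $I,T$ and all call sequences $\sigma,\tau$: if $(I,\sigma)\sim_a(T,\tau)$ then $I[\sigma]_a=T[\tau]_a$.
   Context: Fix a finite set $A$ of agents, $|A|\ge 2$. Secret values are the elements of $A\times\{0,1\}$; write $b$ for $(b,1)$ and $\overline{b}$ for $(b,0)$. For $B\subseteq A\times\{0,1\}$ and $c\in A$, $B^{\pm c}$ is $B$ with the values $c$ and $\overline c$ swapped: simultaneously, $c$ is replaced by $\overline c$ and $\overline c$ by $c$. A secret distribution is a map $S:A\to\mathcal P(A\times\{0,1\})$, $a\mapsto S_a$ (the holding of $a$). An initial secret distribution $I$ satisfies $I_a\in\{\{a\},\{\overline a\}\}$ for every $a$. Calls: for $a\neq b$ in $A$ and $c\in A$ there is the correct call $ab$ (agent $a$ calls $b$ and they exchange their holdings), the faulty call $a^cb$ (from $a$ to $b$, with a transmission error on secret $c$ in what $a$ sends, so that $b$ receives $a$'s holding with the values of $c$ swapped), and the faulty call $ab^c$ (from $a$ to $b$, with a transmission error on secret $c$ in what $b$ sends to $a$). A call sequence is a finite sequence of calls containing at most one faulty call. $\epsilon$ is the empty sequence and $\sigma.\kappa$ appends the call $\kappa$. A gossip state is a pair $(I,\sigma)$ with $I$ initial and $\sigma$ a call sequence. Formulas: $\varphi::=b_a\mid\overline b_a\mid\neg\varphi\mid\varphi\wedge\varphi\mid K_a\varphi$ with $a,b\in A$. The following three notions are defined by simultaneous recursion on the length of the call sequence and on the structure of formulas. (1) Secret distribution after a call sequence. $I[\epsilon]=I$. Let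 $a\neq b$. If the call $\kappa$ does not involve $a$, then $I[\sigma.\kappa]_a=I[\sigma]_a$. If $\kappa\in\{ab,ba,a^cb,ba^c\}$, let $R=I[\sigma]_b$; if $\kappa\in\{ab^c,b^ca\}$, let $R=I[\sigma]_b^{\pm c}$. Then $I[\sigma.\kappa]_a=(I[\sigma]_a\cup(R\setminus *))\setminus **$, where $*=\{d: I,\sigma\models K_a\overline d_d\}\cup\{\overline d: I,\sigma\models K_a d_d\}$, and $**$ is the set of values $d$ such that $T,\tau\models\overline d_d$ for all gossip states $(T,\tau)$ with $(I,\sigma)\sim_a(T,\tau)$ and $I[\sigma]_b=T[\tau]_b$, together with the values $\overline d$ such that $T,\tau\models d_d$ for all such $(T,\tau)$. When $\kappa\in\{ab^c,b^ca\}$, the condition $I[\sigma]_b=T[\tau]_b$ is replaced by $I[\sigma]_b=T[\tau]_b^{\pm c}$. (2) Observation relation. $\sim_a$ is the equivalence closure of the following clauses, for $b\neq a$ and $e\in A$: - $(I,\epsilon)\sim_a(T,\epsilon)$ iff $I_a=T_a$; - $(I,\sigma.ab)\sim_a(T,\tau.ab)$ iff $(I,\sigma)\sim_a(T,\tau)$ and $I[\sigma]_b=T[\tau]_b$; - $(I,\sigma.ab)\sim_a(T,\tau.a^eb)$ iff $(I,\sigma)\sim_a(T,\tau)$ and $I[\sigma]_b=T[\tau]_b$; - $(I,\sigma.ab)\sim_a(T,\tau.ab^e)$ iff $(I,\sigma)\sim_a(T,\tau)$ and $I[\sigma]_b=T[\tau]_b^{\pm e}$; - the same three clauses with $ba,ba^e,b^ea$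 in place of $ab,a^eb,ab^e$; - for a call $\kappa$ (correct or faulty) and a correct call $\kappa'$, neither involving $a$: $(I,\sigma.\kappa)\sim_a(T,\tau.\kappa')$ iff $(I,\sigma)\sim_a(T,\tau)$. Only pairs whose components are call sequences are related. (3) Satisfaction. - $I,\sigma\models b_a$ iff $b\in I[\sigma]_a$; - $I,\sigma\models\overline b_a$ iff $\overline b\in I[\sigma]_a$; - the Boolean clauses are standard; - $I,\sigma\models K_a\varphi$ iff $T,\tau\models\varphi$ for all gossip states $(T,\tau)$ with $(T,\tau)\sim_a(I,\sigma)$. -}

module Defs where

open import Data.Nat using (ℕ; zero; suc; _+_; _≤_)
open import Data.Fin using (Fin; _≟_)
open import Data.Bool using (Bool; true; false; not; if_then_else_)
open import Data.Product using (_×_; _,_; proj₁; proj₂; Σ)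
open import Data.Sum using (_⊎_)
open import Data.Maybe using (Maybe; just; nothing)
open import Data.Unit using (⊤)
open import Relation.Nullary using (¬_; does)
open import Relation.Binary.PropositionalEquality using (_≡_; _≢_)
open import Function.Bundles using (_⇔_)

module _ {n : ℕ} where

  Agent : Set
  Agent = Fin n

  -- Secret values: (b , true) is b, (b , false) is b̄.
  Secret : Set
  Secret = Agent × Bool

  Holding : Set₁
  Holding = Secret → Set

  SameH : Holding → Holding → Set
  SameH B C = ∀ s → B s ⇔ C s

  swapS : Agent → Secret → Secret
  swapS c (d , v) = if does (d ≟ c) then (d , not v) else (d , v)

  swapH : Agent → Holding → Holding
  swapH c B s = B (swapS c s)

  Dist : Set₁
  Dist = Agent → Holding

  Init : Set
  Init = Agent → Bool

  initDist : Init → Dist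
  initDist I a s = s ≡ (a , I a)

  -- Calls:  cor a b = ab,  fromErr a b c = a^c b,  toErr a b c = a b^c
  data Call : Set where
    cor     : Agent → Agent → Call
    fromErr : Agent → Agent → Agent → Call
    toErr   : Agent → Agent → Agent → Call

  caller : Call → Agent
  caller (cor a b) = a
  caller (fromErr a b c) = a
  caller (toErr a b c) = a

  callee : Call → Agent
  callee (cor a b) = b
  callee (fromErr a b c) = b
  callee (toErr a b c) = b

  isFaulty : Call → ℕ
  isFaulty (cor a b) = 0
  isFaulty (fromErr a b c) = 1
  isFaulty (toErr a b c) = 1

  data IsCorrect : Call → Set where
    isCor : ∀ a b → IsCorrect (cor a b)

  Involves : Agent → Call → Set
  Involves x κ = (x ≡ caller κ) ⊎ (x ≡ callee κ)

  infixl 5 _∙_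
  data Seq : ℕ → Set where
    ε   : Seq 0
    _∙_ : ∀ {m} → Seq m → Call → Seq (suc m)

  faults : ∀ {m} → Seq m → ℕ
  faults ε = 0
  faults (σ ∙ κ) = faults σ + isFaulty κ

  Distinct : ∀ {m} → Seq m → Set
  Distinct ε = ⊤
  Distinct (σ ∙ κ) = Distinct σ × (caller κ ≢ callee κ)

  CallSeq : ∀ {m} → Seq m → Set
  CallSeq σ = Distinct σ × (faults σ ≤ 1)

  -- For an agent x and a call κ: if x takes part in κ, the other party b and
  -- whether what x receives is b's holding with secret c swapped (just c).
  recv : Call → Agent → Maybe (Agent × Maybe Agent)
  recv (cor a b) x =
    if does (x ≟ a) then just (b , nothing) else
    (if does (x ≟ b) then just (a , nothing) else nothing)
  recv (fromErr a b c) x =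
    if does (x ≟ a) then just (b , nothing) else
    (if does (x ≟ b) then just (a , just c) else nothing)
  recv (toErr a b c) x =
    if does (x ≟ a) then just (b , just c) else
    (if does (x ≟ b) then just (a , nothing) else nothing)

  data Form : Set where
    has    : Agent → Agent → Form
    hasNeg : Agent → Agent → Form
    ¬'_    : Form → Form
    _∧'_   : Form → Form → Form
    K      : Agent → Form → Form

  data EqCl {X : Set} (V : X → Set) (R : X → X → Set) : X → X → Set where
    ecRefl  : ∀ {x} → V x → EqCl V R x x
    ecBase  : ∀ {x y} → R x y → EqCl V R x y
    ecSym   : ∀ {x y} → EqCl V R x y → EqCl V R y x
    ecTrans : ∀ {x y z} → EqCl V R x y → EqCl V R y z → EqCl V R x z

  GState : ℕ → Set
  GState m = Init × Seq m

  ValidG : ∀ {m} → GState m → Set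
  ValidG (I , σ) = CallSeq σ

  -- The data at a given length m of call sequences:
  -- secret distributions I[σ] and the observation relations ~_a
  -- (which only relate sequences of equal length).
  record Level (m : ℕ) : Set₁ where
    field
      hold : Init → Seq m → Dist
      obs  : Agent → GState m → GState m → Set
  open Level public

  sat : ∀ {m} → Level m → Init → Seq m → Form → Set
  sat L I σ (has b a) = hold L I σ a (b , true)
  sat L I σ (hasNeg b a) = hold L I σ a (b , false)
  sat L I σ (¬' φ) = ¬ sat L I σ φ
  sat L I σ (φ ∧' ψ) = sat L I σ φ × sat L I σ ψ
  sat L I σ (K a φ) = ∀ T τ → obs L a (T , τ) (I , σ) → sat L T τ φ

  data Gen0 (a : Agent) : GState 0 → GState 0 → Set where
    g0 : ∀ {I T} → SameH (initDist I a) (initDist T a) → Gen0 a (I , ε) (T , ε)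

  data GenS {m : ℕ} (L : Level m) (a : Agent) : GState (suc m) → GState (suc m) → Set where
    gAB  : ∀ {I T σ τ} b → b ≢ a → obs L a (I , σ) (T , τ) →
           SameH (hold L I σ b) (hold L T τ b) →
           GenS L a (I , σ ∙ cor a b) (T , τ ∙ cor a b)
    gBA  : ∀ {I T σ τ} b → b ≢ a → obs L a (I , σ) (T , τ) →
           SameH (hold L I σ b) (hold L T τ b) →
           GenS L a (I , σ ∙ cor b a) (T , τ ∙ cor b a)
    gAeB : ∀ {I T σ τ} b e → b ≢ a → obs L a (I , σ) (T , τ) →
           SameH (hold L I σ b) (hold L T τ b) →
           GenS L a (I , σ ∙ cor a b) (T , τ ∙ fromErr a b e)
    gBAe : ∀ {I T σ τ} b e → b ≢ a → obs L a (I , σ) (T , τ) →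
           SameH (hold L I σ b) (hold L T τ b) →
           GenS L a (I , σ ∙ cor b a) (T , τ ∙ toErr b a e)
    gABe : ∀ {I T σ τ} b e → b ≢ a → obs L a (I , σ) (T , τ) →
           SameH (hold L I σ b) (swapH e (hold L T τ b)) →
           GenS L a (I , σ ∙ cor a b) (T , τ ∙ toErr a b e)
    gBeA : ∀ {I T σ τ} b e → b ≢ a → obs L a (I , σ) (T , τ) →
           SameH (hold L I σ b) (swapH e (hold L T τ b)) →
           GenS L a (I , σ ∙ cor b a) (T , τ ∙ fromErr b a e)
    gOther : ∀ {I T σ τ} κ κ' → ¬ Involves a κ → ¬ Involves a κ' → IsCorrect κ' →
           obs L a (I , σ) (T , τ) →
           GenS L a (I , σ ∙ κ) (T , τ ∙ κ')

  Restrict : ∀ {m} → (GState m → GState m → Set) → GState m → GState m → Set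
  Restrict R x y = ValidG x × ValidG y × R x y

  Star : ∀ {m} → Level m → Init → Seq m → Agent → Secret → Set
  Star L I σ x (d , true)  = sat L I σ (K x (hasNeg d d))
  Star L I σ x (d , false) = sat L I σ (K x (has d d))

  Match : ∀ {m} → Level m → Init → Seq m → Agent → Maybe Agent → Init → Seq m → Set
  Match L I σ b nothing  T τ = SameH (hold L I σ b) (hold L T τ b)
  Match L I σ b (just c) T τ = SameH (hold L I σ b) (swapH c (hold L T τ b))

  StarStar : ∀ {m} → Level m → Init → Seq m → Agent → Agent → Maybe Agent → Secret → Set
  StarStar L I σ x b e (d , true) =
    ∀ T τ → obs L x (I , σ) (T , τ) → Match L I σ b e T τ → sat L T τ (hasNeg d d)
  StarStar L I σ x b e (d , false) =
    ∀ T τ → obs L x (I , σ) (T , τ) → Match L I σ b e T τ → sat L T τ (has d d)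

  received : ∀ {m} → Level m → Init → Seq m → Agent → Maybe Agent → Holding
  received L I σ b nothing  = hold L I σ b
  received L I σ b (just c) = swapH c (hold L I σ b)

  update : ∀ {m} → Level m → Init → Seq m → Call → Agent → Holding
  update L I σ κ x with recv κ x
  ... | nothing = hold L I σ x
  ... | just (b , e) = λ s →
        (hold L I σ x s ⊎ (received L I σ b e s × ¬ Star L I σ x s))
        × ¬ StarStar L I σ x b e s

  holdS : ∀ {m} → Level m → Init → Seq (suc m) → Dist
  holdS L I (σ ∙ κ) x = update L I σ κ x

  level : (m : ℕ) → Level m
  level zero = record
    { hold = λ I _ → initDist I
    ; obs  = λ a → EqCl ValidG (Restrict (Gen0 a)) }
  level (suc m) = record
    { hold = holdS (level m)
    ; obs  = λ a → EqCl ValidG (Restrict (GenS (level m) a)) }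

  Hold : ∀ {m} → Init → Seq m → Agent → Holding
  Hold {m} I σ a = hold (level m) I σ a

  Obs : ∀ {m} → Agent → Init → Seq m → Init → Seq m → Set
  Obs {m} a I σ T τ = obs (level m) a (I , σ) (T , τ)

{-# OPTIONS --safe #-}
-- After a call, a's holding is built from a's previous holding, the holding a receives, and the
-- sets * and **. The last two are defined through a's knowledge, hence are constant on
-- ~_a-classes. Each generator of ~_a either pairs two calls in which a receives matching
-- holdings from the same partner (up to the swap the generator records, which ** sees as well),
-- or two calls not involving a. Induction on the length of the call sequences, and for a fixed
-- length on the equivalence closure, therefore shows that ~_a-related states give a the same
-- holding.
module Submission where

open import Defs
open import Data.Nat using (ℕ; zero; suc; _≤_)
open import Data.Fin using (Fin; _≟_)
open import Data.Bool using (true; false)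
open import Data.Bool.Properties using (not-involutive)
open import Data.Maybe using (Maybe; just; nothing)
open import Data.Product using (_×_; _,_)
open import Data.Product.Function.NonDependent.Propositional using (_×-⇔_)
open import Data.Sum using (_⊎_; inj₁; inj₂)
open import Data.Sum.Function.Propositional using (_⊎-⇔_)
open import Function using (_∘_)
open import Function.Bundles using (_⇔_; mk⇔; Equivalence)
open import Function.Construct.Identity using (⇔-id)
open import Function.Indexed.Relation.Binary.Equality using (≡-setoid)
open import Function.Properties.Equivalence using (⇔-setoid)
open import Function.Related.TypeIsomorphisms using (¬-cong-⇔)
open import Level using (0ℓ)
open import Relation.Binary.Bundles using (Setoid)
open import Relation.Binary.Core using (Rel; _=[_]⇒_)
open import Relation.Binary.Indexed.Heterogeneous.Construct.Trivial using (indexedSetoid)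
open import Relation.Binary.PropositionalEquality using (_≡_; _≢_; refl; sym; cong; subst₂)
open import Relation.Binary.Structures using (IsEquivalence)
open import Relation.Nullary using (¬_; yes; no)
open import Relation.Nullary.Decidable using (dec-true; dec-false)

module _ {n : ℕ} where

  private variable
    a b x : Agent {n}
    e : Maybe (Agent {n})
    I T : Init {n}
    B C D : Holding {n}

  -- Its equality is SameH on the nose, so setoid reasoning applies to holdings.
  Holding-setoid : Setoid _ _
  Holding-setoid = ≡-setoid (Secret {n}) (indexedSetoid (⇔-setoid 0ℓ))

  open Setoid Holding-setoid
    using ()
    renaming (isEquivalence to SameH-isEquivalence; sym to SameH-sym; trans to SameH-trans)

  open import Relation.Binary.Reasoning.Setoid Holding-setoid

  swapS-involutive : ∀ c (s : Secret {n}) → swapS c (swapS c s) ≡ s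
  swapS-involutive c (d , v) with d ≟ c in eq
  ... | yes _ rewrite eq = cong (d ,_) (not-involutive v)
  ... | no _  rewrite eq = refl

  swapH-involutive : ∀ c (B : Holding {n}) → SameH (swapH c (swapH c B)) B
  swapH-involutive c B s rewrite swapS-involutive c s = ⇔-id (B s)

  swapH-cong : ∀ c → SameH B C → SameH (swapH c B) (swapH c C)
  swapH-cong c B≈C s = B≈C (swapS c s)

  SameH-swap-transfer : ∀ c → SameH B (swapH c C) → SameH B D ⇔ SameH C (swapH c D)
  SameH-swap-transfer {B} {C} {D} c B≈C′ = mk⇔
    (λ B≈D → begin
      C                      ≈⟨ swapH-involutive c C ⟨
      swapH c (swapH c C)    ≈⟨ swapH-cong c B≈C′ ⟨
      swapH c B              ≈⟨ swapH-cong c B≈D ⟩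
      swapH c D              ∎)
    (λ C≈D′ → begin
      B                      ≈⟨ B≈C′ ⟩
      swapH c C              ≈⟨ swapH-cong c C≈D′ ⟩
      swapH c (swapH c D)    ≈⟨ swapH-involutive c D ⟩
      D                      ∎)

  module _ {X : Set} {V : X → Set} {R : Rel X 0ℓ} {c ℓ} {Y : Set c} {_≈_ : Rel Y ℓ}
           (isEq : IsEquivalence _≈_) (f : X → Y) (R⇒≈ : R =[ f ]⇒ _≈_) where

    private module ≈ = IsEquivalence isEq

    EqCl-gfold : EqCl {n = n} V R =[ f ]⇒ _≈_
    EqCl-gfold (ecRefl _)    = ≈.refl
    EqCl-gfold (ecBase r)    = R⇒≈ r
    EqCl-gfold (ecSym p)     = ≈.sym (EqCl-gfold p)
    EqCl-gfold (ecTrans p q) = ≈.trans (EqCl-gfold p) (EqCl-gfold q)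

  Obs-sym : ∀ m {σ τ : Seq m} → Obs a I σ T τ → Obs a T τ I σ
  Obs-sym zero    = ecSym
  Obs-sym (suc _) = ecSym

  Obs-trans : ∀ m {σ τ υ : Seq m} {U} → Obs a I σ T τ → Obs a T τ U υ → Obs a I σ U υ
  Obs-trans zero    = ecTrans
  Obs-trans (suc _) = ecTrans

  callerError : Call {n} → Maybe (Agent {n})
  callerError (cor _ _)       = nothing
  callerError (fromErr _ _ _) = nothing
  callerError (toErr _ _ c)   = just c

  calleeError : Call {n} → Maybe (Agent {n})
  calleeError (cor _ _)       = nothing
  calleeError (fromErr _ _ c) = just c
  calleeError (toErr _ _ _)   = nothing

  recv-caller : ∀ κ → recv κ (caller κ) ≡ just (callee κ , callerError κ)
  recv-caller (cor a b)       rewrite dec-true (a ≟ a) refl = refl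
  recv-caller (fromErr a b c) rewrite dec-true (a ≟ a) refl = refl
  recv-caller (toErr a b c)   rewrite dec-true (a ≟ a) refl = refl

  recv-callee : ∀ κ → caller κ ≢ callee κ → recv κ (callee κ) ≡ just (caller κ , calleeError κ)
  recv-callee (cor a b)       a≢b
    rewrite dec-false (b ≟ a) (a≢b ∘ sym) | dec-true (b ≟ b) refl = refl
  recv-callee (fromErr a b c) a≢b
    rewrite dec-false (b ≟ a) (a≢b ∘ sym) | dec-true (b ≟ b) refl = refl
  recv-callee (toErr a b c)   a≢b
    rewrite dec-false (b ≟ a) (a≢b ∘ sym) | dec-true (b ≟ b) refl = refl

  recv-uninvolved : ∀ κ → ¬ Involves x κ → recv κ x ≡ nothing
  recv-uninvolved {x} (cor a b)       x∉κ
    rewrite dec-false (x ≟ a) (x∉κ ∘ inj₁) | dec-false (x ≟ b) (x∉κ ∘ inj₂) = refl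
  recv-uninvolved {x} (fromErr a b c) x∉κ
    rewrite dec-false (x ≟ a) (x∉κ ∘ inj₁) | dec-false (x ≟ b) (x∉κ ∘ inj₂) = refl
  recv-uninvolved {x} (toErr a b c)   x∉κ
    rewrite dec-false (x ≟ a) (x∉κ ∘ inj₁) | dec-false (x ≟ b) (x∉κ ∘ inj₂) = refl

  module _ (m : ℕ) where

    private variable
      σ τ : Seq {n} m

    K-cong : Obs a I σ T τ → ∀ φ → sat (level m) I σ (K a φ) ⇔ sat (level m) T τ (K a φ)
    K-cong I~T φ = mk⇔
      (λ I⊨Kφ T′ τ′ T′~T → I⊨Kφ T′ τ′ (Obs-trans m T′~T (Obs-sym m I~T)))
      (λ T⊨Kφ T′ τ′ T′~I → T⊨Kφ T′ τ′ (Obs-trans m T′~I I~T))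

    Star-cong : Obs a I σ T τ → ∀ s → Star (level m) I σ a s ⇔ Star (level m) T τ a s
    Star-cong I~T (d , true)  = K-cong I~T (hasNeg d d)
    Star-cong I~T (d , false) = K-cong I~T (has d d)

    guardedK-cong : {P P′ Q : Init → Seq m → Set} →
                    Obs a I σ T τ → (∀ T′ τ′ → P T′ τ′ ⇔ P′ T′ τ′) →
                    (∀ T′ τ′ → Obs a I σ T′ τ′ → P T′ τ′ → Q T′ τ′) ⇔
                    (∀ T′ τ′ → Obs a T τ T′ τ′ → P′ T′ τ′ → Q T′ τ′)
    guardedK-cong I~T P⇔P′ = mk⇔
      (λ h T′ τ′ T~T′ p′ → h T′ τ′ (Obs-trans m I~T T~T′) (Equivalence.from (P⇔P′ T′ τ′) p′))
      (λ h T′ τ′ I~T′ p → h T′ τ′ (Obs-trans m (Obs-sym m I~T) I~T′) (Equivalence.to (P⇔P′ T′ τ′) p))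

    StarStar-cong : ∀ {e e′} → Obs a I σ T τ →
                    (∀ T′ τ′ → Match (level m) I σ b e T′ τ′ ⇔ Match (level m) T τ b e′ T′ τ′) →
                    ∀ s → StarStar (level m) I σ a b e s ⇔ StarStar (level m) T τ a b e′ s
    StarStar-cong I~T M⇔M′ (d , true)  = guardedK-cong I~T M⇔M′
    StarStar-cong I~T M⇔M′ (d , false) = guardedK-cong I~T M⇔M′

    -- The guard of ** after a correct call compares b's holding directly, after a faulty one through
    -- the swap; a generator's hypothesis on b's holdings makes the two guards agree.
    Match-transfer : ∀ (L : Level m) e → Match L I σ b e T τ →
                     ∀ T′ τ′ → Match L I σ b nothing T′ τ′ ⇔ Match L T τ b e T′ τ′
    Match-transfer L nothing  I≈T _ _ = mk⇔ (SameH-trans (SameH-sym I≈T)) (SameH-trans I≈T)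
    Match-transfer L (just c) I≈T _ _ = SameH-swap-transfer c I≈T

    Match⇒received : ∀ (L : Level m) e → Match L I σ b e T τ →
                     SameH (received L I σ b nothing) (received L T τ b e)
    Match⇒received L nothing  I≈T = I≈T
    Match⇒received L (just c) I≈T = I≈T

    merged : Level {n} m → Init → Seq m → Agent → Agent → Maybe Agent → Holding
    merged L I σ x b e s =
      (hold L I σ x s ⊎ (received L I σ b e s × ¬ Star L I σ x s)) × ¬ StarStar L I σ x b e s

    update-heard : ∀ (L : Level m) κ → recv κ x ≡ just (b , e) →
                   update L I σ κ x ≡ merged L I σ x b e
    update-heard L κ heard rewrite heard = refl

    update-silent : ∀ (L : Level m) κ → recv κ x ≡ nothing → update L I σ κ x ≡ hold L I σ x
    update-silent L κ silent rewrite silent = refl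

    merged-cong : Obs a I σ T τ → SameH (Hold I σ a) (Hold T τ a) → Match (level m) I σ b e T τ →
                  SameH (merged (level m) I σ a b nothing) (merged (level m) T τ a b e)
    merged-cong {e = e} I~T a-agrees b-matches s =
      (a-agrees s ⊎-⇔ (Match⇒received _ e b-matches s ×-⇔ ¬-cong-⇔ (Star-cong I~T s)))
      ×-⇔ ¬-cong-⇔ (StarStar-cong I~T (Match-transfer _ e b-matches) s)

    Hold-heard-cong : ∀ κ κ′ → recv κ a ≡ just (b , nothing) → recv κ′ a ≡ just (b , e) →
                      Obs a I σ T τ → SameH (Hold I σ a) (Hold T τ a) → Match (level m) I σ b e T τ →
                      SameH (Hold I (σ ∙ κ) a) (Hold T (τ ∙ κ′) a)
    Hold-heard-cong κ κ′ heard heard′ I~T a-agrees b-matches =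
      subst₂ SameH (sym (update-heard _ κ heard)) (sym (update-heard _ κ′ heard′))
        (merged-cong I~T a-agrees b-matches)

    Hold-caller-cong : ∀ κ → let a = caller κ; b = callee κ in
                       Obs a I σ T τ → SameH (Hold I σ a) (Hold T τ a) →
                       Match (level m) I σ b (callerError κ) T τ →
                       SameH (Hold I (σ ∙ cor a b) a) (Hold T (τ ∙ κ) a)
    Hold-caller-cong κ = Hold-heard-cong ab κ (recv-caller ab) (recv-caller κ)
      where ab = cor (caller κ) (callee κ)

    Hold-callee-cong : ∀ κ → let b = caller κ; a = callee κ in b ≢ a →
                       Obs a I σ T τ → SameH (Hold I σ a) (Hold T τ a) →
                       Match (level m) I σ b (calleeError κ) T τ →
                       SameH (Hold I (σ ∙ cor b a) a) (Hold T (τ ∙ κ) a)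
    Hold-callee-cong κ b≢a = Hold-heard-cong ba κ (recv-callee ba b≢a) (recv-callee κ b≢a)
      where ba = cor (caller κ) (callee κ)

    Hold-uninvolved-cong : ∀ κ κ′ → ¬ Involves a κ → ¬ Involves a κ′ → SameH (Hold I σ a) (Hold T τ a) →
                           SameH (Hold I (σ ∙ κ) a) (Hold T (τ ∙ κ′) a)
    Hold-uninvolved-cong κ κ′ a∉κ a∉κ′ =
      subst₂ SameH (sym (update-silent _ κ (recv-uninvolved κ a∉κ)))
                   (sym (update-silent _ κ′ (recv-uninvolved κ′ a∉κ′)))

  holding : ∀ {m} → Agent {n} → GState m → Holding
  holding a (I , σ) = Hold I σ a

  Obs⇒SameHold : ∀ m {σ τ : Seq m} → Obs a I σ T τ → SameH (Hold I σ a) (Hold T τ a)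
  GenS⇒SameHold : ∀ m {x y} → GenS (level m) a x y → SameH (holding a x) (holding a y)

  Obs⇒SameHold {a = a} zero =
    EqCl-gfold SameH-isEquivalence (holding a) λ { (_ , _ , g0 same) → same }
  Obs⇒SameHold {a = a} (suc m) =
    EqCl-gfold SameH-isEquivalence (holding a) λ { (_ , _ , g) → GenS⇒SameHold m g }

  GenS⇒SameHold m (gAB b _ I~T agree) =
    Hold-caller-cong m (cor _ b) I~T (Obs⇒SameHold m I~T) agree
  GenS⇒SameHold m (gAeB b e _ I~T agree) =
    Hold-caller-cong m (fromErr _ b e) I~T (Obs⇒SameHold m I~T) agree
  GenS⇒SameHold m (gABe b e _ I~T match) =
    Hold-caller-cong m (toErr _ b e) I~T (Obs⇒SameHold m I~T) match
  GenS⇒SameHold m (gBA b b≢a I~T agree) =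
    Hold-callee-cong m (cor b _) b≢a I~T (Obs⇒SameHold m I~T) agree
  GenS⇒SameHold m (gBAe b e b≢a I~T agree) =
    Hold-callee-cong m (toErr b _ e) b≢a I~T (Obs⇒SameHold m I~T) agree
  GenS⇒SameHold m (gBeA b e b≢a I~T match) =
    Hold-callee-cong m (fromErr b _ e) b≢a I~T (Obs⇒SameHold m I~T) match
  GenS⇒SameHold m (gOther κ κ′ a∉κ a∉κ′ _ I~T) =
    Hold-uninvolved-cong m κ κ′ a∉κ a∉κ′ (Obs⇒SameHold m I~T)

lemma1 : {n : ℕ} → 2 ≤ n → (a : Fin n) (I T : Init) {m : ℕ} (σ τ : Seq m) →
    CallSeq σ → CallSeq τ → Obs a I σ T τ → SameH (Hold I σ a) (Hold T τ a)
lemma1 _ a I T {m} σ τ _ _ = Obs⇒SameHold m
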